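{- Let $m\ge1$ and let $w=w_1\otimes\cdots\otimes w_{m+1}$ be a word with letters $w_i\in\{X,Y,Z\}$ such that: (1) $w$ contains at least one $Z$; (2) $w_1\in\{X,Z\}$; (3) $w_{m+1}\in\{X,Z\}$; (4) the first letter of $w$ different from $X$ is $Z$ and the last letter of $w$ different from $X$ is $Z$ (i.e. $w$ begins with $k\ge0$ copies of $X$ followed by $Z$ and ends with $Z$ followed by $\ell\ge0$ copies of $X$); (5) the letters $Z$ and $Y$ alternate in $w$ (between any two occurrences of $Z$ there is a $Y$, and between any two occurrences of $Y$ there is a $Z$). Then $w$ is a term of $X\cdot P^m\cdot X\in B^{\otimes(m+1)}$, i.e. its coefficient is nonzero.
   Context: Let $\mathcal M=\mathbb Z\langle y,n\rangle/(yn=ny=n,\ n^2=0,\ y^2=y)$. In the ring $\mathcal M\otimes\mathcal M$ (tensor over $\mathbb Z$, with $(a\otimes b)(c\otimes d)=ac\otimes bd$) put $X=y\otimes n+n\otimes y$, $Y=y\otimes y$, $Z=n\otimes n$, and let $B$ be the $\mathbb Z$-span of $X,Y,Z$: a commutative subring, free abelian with basis $X,Y,Z$, with $X^2=2Z$, $Y^2=Y$, $Z^2=0$, $XY=YX=X$, $XZ=ZX=0$, $YZ=ZY=Z$. For $r\ge1$, $B^{\otimes r}$ is free abelian with basis the words $w_1\otimes\cdots\otimes w_r$, $w_i\in\{X,Y,Z\}$; writing $u\in B^{\otimes r}$ uniquely as $\sum_w c_w w$, a term of $u$ is a word $w$ with $c_w\ne0$, and $c_w$ is its coefficient. The chaining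 product $B^{\otimes r}\times B^{\otimes s}\to B^{\otimes(r+s-1)}$ is the bilinear (associative) map $(a_1\otimes\cdots\otimes a_r)\cdot(b_1\otimes\cdots\otimes b_s)=a_1\otimes\cdots\otimes a_{r-1}\otimes(a_rb_1)\otimes b_2\otimes\cdots\otimes b_s$. Elements of $B$ are regarded as elements of $B^{\otimes1}$. Let $P=X\otimes Y+Y\otimes X\in B^{\otimes2}$ and let $P^m\in B^{\otimes(m+1)}$ be its $m$-fold chaining product. -}

module Defs where

open import Data.Nat using (ℕ; zero; suc)
open import Data.Integer using (ℤ; +_; _+_; _*_)
open import Data.List using (List; []; _∷_; map; concatMap; _++_)
open import Data.Product using (_×_; _,_)
open import Relation.Nullary using (Dec; yes; no)
open import Relation.Binary.PropositionalEquality using (_≡_; refl)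
import Data.List.Properties as LP

data Letter : Set where
  X Y Z : Letter

_≟L_ : (a b : Letter) → Dec (a ≡ b)
X ≟L X = yes refl
X ≟L Y = no λ ()
X ≟L Z = no λ ()
Y ≟L X = no λ ()
Y ≟L Y = yes refl
Y ≟L Z = no λ ()
Z ≟L X = no λ ()
Z ≟L Y = no λ ()
Z ≟L Z = yes refl

mulL : Letter → Letter → List (ℤ × Letter)
mulL X X = (+ 2 , Z) ∷ []
mulL X Y = (+ 1 , X) ∷ []
mulL X Z = []
mulL Y X = (+ 1 , X) ∷ []
mulL Y Y = (+ 1 , Y) ∷ []
mulL Y Z = (+ 1 , Z) ∷ []
mulL Z X = []
mulL Z Y = (+ 1 , Z) ∷ []
mulL Z Z = []

Word : Set
Word = List Letter

-- An element of B^{⊗r}: a formal Z-linear combination of words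
-- (a finite list of (coefficient , word) pairs, repetitions allowed).
Tensor : Set
Tensor = List (ℤ × Word)

-- Chaining product of two words (for nonempty words):
-- (a₁⊗⋯⊗a_r)·(b₁⊗⋯⊗b_s) = a₁⊗⋯⊗a_{r-1}⊗(a_r b₁)⊗b₂⊗⋯⊗b_s.
chainWord : Word → Word → Tensor
chainWord [] _ = []
chainWord (a ∷ []) [] = []
chainWord (a ∷ []) (b ∷ bs) = map (λ { (c , l) → (c , l ∷ bs) }) (mulL a b)
chainWord (a ∷ a' ∷ as) bs =
  map (λ { (c , v) → (c , a ∷ v) }) (chainWord (a' ∷ as) bs)

chain : Tensor → Tensor → Tensor
chain u v =
  concatMap (λ { (c , w) →
    concatMap (λ { (d , w') →
      map (λ { (e , r) → (c * d * e , r) }) (chainWord w w') }) v }) u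

coeff : Tensor → Word → ℤ
coeff [] w = + 0
coeff ((c , v) ∷ t) w with LP.≡-dec _≟L_ v w
... | yes _ = c + coeff t w
... | no _ = coeff t w

Xt : Tensor
Xt = (+ 1 , X ∷ []) ∷ []

P : Tensor
P = (+ 1 , X ∷ Y ∷ []) ∷ (+ 1 , Y ∷ X ∷ []) ∷ []

-- P^m (m-fold chaining product); P^0 is taken to be the unit Y of B
-- (only m ≥ 1 is used), so Ppow 1 = Y · P = P.
Ppow : ℕ → Tensor
Ppow zero = (+ 1 , Y ∷ []) ∷ []
Ppow (suc m) = chain (Ppow m) P

XPX : ℕ → Tensor
XPX m = chain (chain Xt (Ppow m)) Xt

{-# OPTIONS --safe #-}

-- All structure constants of B are nonnegative, so every coefficient of X·P^m·X
-- is a sum of nonnegative products and a word is a term as soon as one choice of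
-- summands f₁,…,f_m ∈ {X⊗Y, Y⊗X} of the factors P produces it. Letter i of that
-- product is (last letter of f_{i-1})·(first letter of f_i), where the outer X's
-- act as the last letter of f₀ = Y⊗X and the first letter of f_{m+1} = X⊗Y: it
-- is X when f_{i-1} = f_i, Y when X⊗Y is followed by Y⊗X and 2Z when Y⊗X is
-- followed by X⊗Y. So the words produced are those read by the two-state
-- automaton that keeps its state on X and switches on Y (from X⊗Y) or Z (from
-- Y⊗X), run from Y⊗X to X⊗Y. The hypotheses say exactly that w is read this
-- way: the state after a prefix is X⊗Y if its last non-X letter is Z, and Y⊗X if
-- it is Y or there is none.

module Submission where

open import Defs
open import Data.Nat using (ℕ; suc) renaming (_≤_ to _≤ℕ_)
open import Data.Fin using (Fin; _<_; zero; fromℕ)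
open import Data.Vec using (Vec; lookup; toList)
open import Data.Product using (Σ; _×_)
open import Data.Integer using (+_)
open import Relation.Binary.PropositionalEquality using (_≡_; _≢_)

open import Data.Nat using (zero; z≤n; s≤s)
open import Data.Fin using (suc)
open import Data.Vec using ([]; _∷_; initLast)
open import Data.Vec.Properties using (toList-∷ʳ)
open import Data.Integer using (ℤ; +[1+_]; _+_; _*_; Positive; NonNegative)
open import Data.Integer.Properties using (pos-*; +-comm)
open import Data.List using (List; []; _∷_; _++_)
open import Data.List.Properties using (≡-dec; ++-identityʳ)
open import Data.List.Membership.Propositional using (_∈_)
open import Data.List.Membership.Propositional.Properties using (∈-map⁺; ∈-concat⁺′)
open import Data.List.Relation.Unary.Any using (here; there)
open import Data.List.Relation.Unary.All as All using (All; []; _∷_)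
open import Data.List.Relation.Unary.All.Properties using (map⁺; concat⁺)
open import Data.Product using (_,_; proj₁)
open import Data.Empty using (⊥-elim)
open import Function using (_∘_; case_of_)
open import Relation.Binary.PropositionalEquality using (refl; sym; trans; cong; subst)
open import Relation.Nullary using (yes; no)

*-nonNeg : ∀ {i j} → NonNegative i → NonNegative j → NonNegative (i * j)
*-nonNeg {+ m} {+ n} _ _ = subst NonNegative (pos-* m n) _

*-pos : ∀ {i j} → Positive i → Positive j → Positive (i * j)
*-pos {+[1+ m ]} {+[1+ n ]} _ _ = _

+-nonNeg : ∀ {i j} → NonNegative i → NonNegative j → NonNegative (i + j)
+-nonNeg {+ m} {+ n} _ _ = _

pos+nonNeg : ∀ {i j} → Positive i → NonNegative j → Positive (i + j)
pos+nonNeg {+[1+ m ]} {+ n} _ _ = _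

nonNeg+pos : ∀ {i j} → NonNegative i → Positive j → Positive (i + j)
nonNeg+pos {i} {j} i≥0 j>0 = subst Positive (+-comm j i) (pos+nonNeg j>0 i≥0)

pos⇒≢0 : ∀ {i} → Positive i → i ≢ + 0
pos⇒≢0 {+[1+ n ]} _ ()

NonNegativeCoeffs : {A : Set} → List (ℤ × A) → Set
NonNegativeCoeffs = All (NonNegative ∘ proj₁)

_∈⁺_ : {A : Set} → A → List (ℤ × A) → Set
x ∈⁺ t = Σ ℤ λ c → Positive c × (c , x) ∈ t

coeff-nonNeg : ∀ {t} w → NonNegativeCoeffs t → NonNegative (coeff t w)
coeff-nonNeg {[]} w [] = _
coeff-nonNeg {(c , v) ∷ t} w (c≥0 ∷ t≥0) with ≡-dec _≟L_ v w
... | yes _ = +-nonNeg c≥0 (coeff-nonNeg w t≥0)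
... | no _ = coeff-nonNeg w t≥0

coeff-pos : ∀ {t w} → NonNegativeCoeffs t → w ∈⁺ t → Positive (coeff t w)
coeff-pos {(c , v) ∷ t} {w} (c≥0 ∷ t≥0) (d , d>0 , w∈t) with ≡-dec _≟L_ v w | w∈t
... | yes _  | here refl = pos+nonNeg d>0 (coeff-nonNeg w t≥0)
... | yes _  | there w∈t′ = nonNeg+pos c≥0 (coeff-pos t≥0 (d , d>0 , w∈t′))
... | no v≢w | here refl = ⊥-elim (v≢w refl)
... | no _   | there w∈t′ = coeff-pos t≥0 (d , d>0 , w∈t′)

mulL-nonNeg : ∀ a b → NonNegativeCoeffs (mulL a b)
mulL-nonNeg X X = _ ∷ []
mulL-nonNeg X Y = _ ∷ []
mulL-nonNeg X Z = []
mulL-nonNeg Y X = _ ∷ []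
mulL-nonNeg Y Y = _ ∷ []
mulL-nonNeg Y Z = _ ∷ []
mulL-nonNeg Z X = []
mulL-nonNeg Z Y = _ ∷ []
mulL-nonNeg Z Z = []

chainWord-nonNeg : ∀ v w → NonNegativeCoeffs (chainWord v w)
chainWord-nonNeg [] _ = []
chainWord-nonNeg (a ∷ []) [] = []
chainWord-nonNeg (a ∷ []) (b ∷ _) = map⁺ (mulL-nonNeg a b)
chainWord-nonNeg (_ ∷ a ∷ as) w = map⁺ (chainWord-nonNeg (a ∷ as) w)

chain-nonNeg : ∀ {t u} → NonNegativeCoeffs t → NonNegativeCoeffs u → NonNegativeCoeffs (chain t u)
chain-nonNeg t≥0 u≥0 =
  concat⁺ (map⁺ (All.map (λ {(_ , v)} c≥0 →
    concat⁺ (map⁺ (All.map (λ {(_ , w)} d≥0 →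
      map⁺ (All.map (*-nonNeg (*-nonNeg c≥0 d≥0)) (chainWord-nonNeg v w)))
    u≥0)))
  t≥0))

Xt-nonNeg : NonNegativeCoeffs Xt
Xt-nonNeg = _ ∷ []

P-nonNeg : NonNegativeCoeffs P
P-nonNeg = _ ∷ _ ∷ []

Ppow-nonNeg : ∀ m → NonNegativeCoeffs (Ppow m)
Ppow-nonNeg zero = _ ∷ []
Ppow-nonNeg (suc m) = chain-nonNeg (Ppow-nonNeg m) P-nonNeg

XPX-nonNeg : ∀ m → NonNegativeCoeffs (XPX m)
XPX-nonNeg m = chain-nonNeg (chain-nonNeg Xt-nonNeg (Ppow-nonNeg m)) Xt-nonNeg

∈⁺-chain : ∀ {t u v w r} → v ∈⁺ t → w ∈⁺ u → r ∈⁺ chainWord v w → r ∈⁺ chain t u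
∈⁺-chain (c , c>0 , v∈t) (d , d>0 , w∈u) (e , e>0 , r∈vw) =
  c * d * e , *-pos (*-pos c>0 d>0) e>0 ,
  ∈-concat⁺′ (∈-concat⁺′ (∈-map⁺ _ r∈vw) (∈-map⁺ _ w∈u)) (∈-map⁺ _ v∈t)

data Factor : Set where
  XY YX : Factor

-- joint f g is the basis letter of (last letter of f)·(first letter of g). As Y
-- is the unit of B, joint XY g is the first letter of g and joint f YX the last
-- letter of f; so joints XY fs YX is the word of P^m picked by fs, and
-- joints YX fs XY the word of X·P^m·X.
joint : Factor → Factor → Letter
joint XY XY = X
joint XY YX = Y
joint YX XY = Z
joint YX YX = X

joints : Factor → List Factor → Factor → Word
joints f [] g = joint f g ∷ []
joints f (h ∷ hs) g = joint f h ∷ joints h hs g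

joint-∈⁺-mulL : ∀ f g → joint f g ∈⁺ mulL (joint f YX) (joint XY g)
joint-∈⁺-mulL XY XY = + 1 , _ , here refl
joint-∈⁺-mulL XY YX = + 1 , _ , here refl
joint-∈⁺-mulL YX XY = + 2 , _ , here refl
joint-∈⁺-mulL YX YX = + 1 , _ , here refl

joints-∈⁺-P : ∀ f → joints XY (f ∷ []) YX ∈⁺ P
joints-∈⁺-P XY = + 1 , _ , here refl
joints-∈⁺-P YX = + 1 , _ , there (here refl)

joints-∈⁺-chainWord : ∀ f fs gs g →
  joints f (fs ++ gs) g ∈⁺ chainWord (joints f fs YX) (joints XY gs g)
joints-∈⁺-chainWord f [] [] g with joint-∈⁺-mulL f g
... | c , c>0 , fg∈ = c , c>0 , ∈-map⁺ _ fg∈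
joints-∈⁺-chainWord f [] (h ∷ _) g with joint-∈⁺-mulL f h
... | c , c>0 , fh∈ = c , c>0 , ∈-map⁺ _ fh∈
joints-∈⁺-chainWord f (h ∷ []) gs g with joints-∈⁺-chainWord h [] gs g
... | c , c>0 , w∈ = c , c>0 , ∈-map⁺ _ w∈
joints-∈⁺-chainWord f (h ∷ h′ ∷ hs) gs g with joints-∈⁺-chainWord h (h′ ∷ hs) gs g
... | c , c>0 , w∈ = c , c>0 , ∈-map⁺ _ w∈

joints-∈⁺-chain : ∀ {t u f g} fs gs → joints f fs YX ∈⁺ t → joints XY gs g ∈⁺ u →
  joints f (fs ++ gs) g ∈⁺ chain t u
joints-∈⁺-chain {f = f} {g} fs gs fs∈t gs∈u =
  ∈⁺-chain fs∈t gs∈u (joints-∈⁺-chainWord f fs gs g)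

X∈⁺Xt : (X ∷ []) ∈⁺ Xt
X∈⁺Xt = + 1 , _ , here refl

joints-∈⁺-Ppow : ∀ {m} (fs : Vec Factor m) → joints XY (toList fs) YX ∈⁺ Ppow m
joints-∈⁺-Ppow {zero} [] = + 1 , _ , here refl
joints-∈⁺-Ppow {suc _} fs with initLast fs
... | hs , h , refl rewrite toList-∷ʳ h hs =
  joints-∈⁺-chain (toList hs) (h ∷ []) (joints-∈⁺-Ppow hs) (joints-∈⁺-P h)

joints-∈⁺-XPX : ∀ {m} (fs : Vec Factor m) → joints YX (toList fs) XY ∈⁺ XPX m
joints-∈⁺-XPX fs = subst (λ hs → joints YX hs XY ∈⁺ _) (++-identityʳ (toList fs))
  (joints-∈⁺-chain (toList fs) [] (joints-∈⁺-chain [] (toList fs) X∈⁺Xt (joints-∈⁺-Ppow fs)) X∈⁺Xt)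

module _ {n : ℕ} where

  FirstNonXIsNot : Letter → Vec Letter n → Set
  FirstNonXIsNot c w = (i : Fin n) → lookup w i ≢ X →
    ((j : Fin n) → j < i → lookup w j ≡ X) → lookup w i ≢ c

  LastNonXIs : Letter → Vec Letter n → Set
  LastNonXIs c w = (i : Fin n) → lookup w i ≢ X →
    ((j : Fin n) → i < j → lookup w j ≡ X) → lookup w i ≡ c

  Separated : Letter → Letter → Vec Letter n → Set
  Separated c d w = (i j : Fin n) → i < j → lookup w i ≡ c → lookup w j ≡ c →
    Σ (Fin n) (λ k → (i < k) × (k < j) × (lookup w k ≡ d))

  Alternating : Vec Letter n → Set
  Alternating w = Separated Z Y w × Separated Y Z w

  AllX : Vec Letter n → Set
  AllX w = (i : Fin n) → lookup w i ≡ X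

module _ {n : ℕ} {w : Vec Letter n} where

  FirstNonXIsNot-tail : ∀ {c} → FirstNonXIsNot c (X ∷ w) → FirstNonXIsNot c w
  FirstNonXIsNot-tail first i wᵢ≢X before =
    first (suc i) wᵢ≢X λ { zero _ → refl ; (suc j) (s≤s j<i) → before j j<i }

  LastNonXIs-tail : ∀ {a c} → LastNonXIs c (a ∷ w) → LastNonXIs c w
  LastNonXIs-tail last i wᵢ≢X after =
    last (suc i) wᵢ≢X λ { (suc j) (s≤s i<j) → after j i<j }

  Separated-tail : ∀ {a c d} → Separated c d (a ∷ w) → Separated c d w
  Separated-tail sep i j i<j wᵢ≡c wⱼ≡c with sep (suc i) (suc j) (s≤s i<j) wᵢ≡c wⱼ≡c
  ... | suc k , s≤s i<k , s≤s k<j , wₖ≡d = k , i<k , k<j , wₖ≡d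

  Alternating-tail : ∀ {a} → Alternating (a ∷ w) → Alternating w
  Alternating-tail (sepZ , sepY) = Separated-tail sepZ , Separated-tail sepY

  AllX-cons : AllX w → AllX (X ∷ w)
  AllX-cons allX zero = refl
  AllX-cons allX (suc i) = allX i

FirstNonXIsNot-after : ∀ {n c d} {w : Vec Letter n} → d ≢ X → Separated c d (c ∷ w) → FirstNonXIsNot c w
FirstNonXIsNot-after d≢X sep i _ before wᵢ≡c with sep zero (suc i) (s≤s z≤n) refl wᵢ≡c
... | suc k , _ , s≤s k<i , wₖ≡d = d≢X (trans (sym wₖ≡d) (before k k<i))

lastNonX : Factor → Letter
lastNonX XY = Z
lastNonX YX = Y

joint-diag : ∀ f → X ≡ joint f f
joint-diag XY = refl
joint-diag YX = refl

readHead : ∀ {n} s a (w : Vec Letter n) →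
  FirstNonXIsNot (lastNonX s) (a ∷ w) → (AllX (a ∷ w) → s ≡ XY) →
  LastNonXIs Z (a ∷ w) → Alternating (a ∷ w) →
  Σ Factor λ t → a ≡ joint s t × FirstNonXIsNot (lastNonX t) w × (AllX w → t ≡ XY)
readHead s X w first final _ _ =
  s , joint-diag s , FirstNonXIsNot-tail first , final ∘ AllX-cons
readHead XY Y w _ _ last (_ , sepY) =
  YX , refl , FirstNonXIsNot-after (λ ()) sepY ,
  λ allX → case last zero (λ ()) (λ { (suc j) _ → allX j }) of λ ()
readHead YX Z w _ _ _ (sepZ , _) =
  XY , refl , FirstNonXIsNot-after (λ ()) sepZ , λ _ → refl
readHead XY Z w first _ _ _ = ⊥-elim (first zero (λ ()) (λ _ ()) refl)
readHead YX Y w first _ _ _ = ⊥-elim (first zero (λ ()) (λ _ ()) refl)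

factorise : ∀ {n} s (w : Vec Letter (suc n)) →
  FirstNonXIsNot (lastNonX s) w → (AllX w → s ≡ XY) →
  LastNonXIs Z w → Alternating w →
  Σ (Vec Factor n) λ fs → toList w ≡ joints s (toList fs) XY
factorise s (a ∷ []) first final last alt with readHead s a [] first final last alt
... | t , refl , _ , final′ with final′ (λ ())
... | refl = [] , refl
factorise s (a ∷ b ∷ w) first final last alt with readHead s a (b ∷ w) first final last alt
... | t , refl , first′ , final′ with factorise t (b ∷ w) first′ final′ (LastNonXIs-tail last) (Alternating-tail alt)
... | fs , w≡ = t ∷ fs , cong (joint s t ∷_) w≡

lemma4p8 : (m : ℕ) → 1 ≤ℕ m → (w : Vec Letter (suc m)) →
    Σ (Fin (suc m)) (λ i → lookup w i ≡ Z) →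
    lookup w zero ≢ Y →
    lookup w (fromℕ m) ≢ Y →
    ((i : Fin (suc m)) → lookup w i ≢ X →
      ((j : Fin (suc m)) → j < i → lookup w j ≡ X) → lookup w i ≡ Z) →
    ((i : Fin (suc m)) → lookup w i ≢ X →
      ((j : Fin (suc m)) → i < j → lookup w j ≡ X) → lookup w i ≡ Z) →
    ((i j : Fin (suc m)) → i < j → lookup w i ≡ Z → lookup w j ≡ Z →
      Σ (Fin (suc m)) (λ k → (i < k) × (k < j) × (lookup w k ≡ Y))) →
    ((i j : Fin (suc m)) → i < j → lookup w i ≡ Y → lookup w j ≡ Y →
      Σ (Fin (suc m)) (λ k → (i < k) × (k < j) × (lookup w k ≡ Z))) →
    coeff (XPX m) (toList w) ≢ + 0
lemma4p8 m _ w (i , wᵢ≡Z) _ _ firstZ lastZ sepZ sepY =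
  let fs , w≡ = factorise YX w notY notAllX lastZ (sepZ , sepY)
  in pos⇒≢0 (coeff-pos (XPX-nonNeg m) (subst (_∈⁺ XPX m) (sym w≡) (joints-∈⁺-XPX fs)))
  where
  notY : FirstNonXIsNot Y w
  notY j wⱼ≢X before wⱼ≡Y = case trans (sym (firstZ j wⱼ≢X before)) wⱼ≡Y of λ ()
  notAllX : AllX w → YX ≡ XY
  notAllX allX = case trans (sym wᵢ≡Z) (allX i) of λ ()
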